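{- The functor $F_2:\mathsf{Cat}\to\mathsf{FBC}$ is left adjoint to the forgetful functor $U_2:\mathsf{FBC}\to\mathsf{Cat}$, with unit at a category $\mathsf C$ given by the taping functor $\lceil\cdot\rceil:\mathsf C\to U_2F_2(\mathsf C)$, which is the identity on objects (seen as one-letter words) and sends $c$ to $\lceil c\rceil$.
   Context: $\mathsf{Cat}$ is the category of categories and functors. A strict finite biproduct (fb) category is a strict symmetric monoidal category $(\mathsf D,\oplus,0)$ in which every object $X$ carries a commutative monoid $\nabla_X:X\oplus X\to X$, $\mathsf i_X:0\to X$ and a cocommutative comonoid $\Delta_X:X\to X\oplus X$, $!_X:X\to0$, compatible with $\oplus$ via the standard coherence conditions, such that every arrow $f:X\to Y$ satisfies $(f\oplus f);\nabla_Y=\nabla_X;f$, $\mathsf i_X;f=\mathsf i_Y$, $f;\Delta_Y=\Delta_X;(f\oplus f)$, $f;!_Y=!_X$. $\mathsf{FBC}$ is the category of strict fb categories and strict symmetric monoidal functors preserving these (co)monoids; $U_2$ forgets the structure. For a category $\mathsf C$, $F_2(\mathsf C)$ has objects finite words of objects of $\mathsf C$ ($\oplus$ concatenation, $0$ empty word) and arrows the terms generated by $\mathrm{id}_A,\mathrm{id}_0$, $\lceil c\rceil$ for arrows $c$ of $\mathsf C$, $\sigma^\oplus_{A,B}$, $!_A,\Delta_A,\mathsf i_A,\nabla_A$ ($A,B$ objects of $\mathsf C$), $;$ and $\oplus$, modulo the strict symmetric monoidal laws, the (co)commutative (co)monoid laws, the bialgebra laws, naturality of $\Delta,!,\nabla,\mathsf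 i$ w.r.t. each $\lceil c\rceil$, and $\lceil\mathrm{id}_A\rceil=\mathrm{id}_A$, $\lceil c;d\rceil=\lceil c\rceil;\lceil d\rceil$; on functors $H:\mathsf C\to\mathsf C'$, $F_2(H)$ acts by applying $H$ to objects and inside each $\lceil c\rceil$. -}

module Defs where

open import Level using (Level; _⊔_) renaming (suc to lsuc)
open import Relation.Binary.PropositionalEquality
  using (_≡_; refl; sym; trans; cong; subst; subst₂)
open import Relation.Binary using (Rel; IsEquivalence)
open import Data.List using (List; []; _∷_; _++_; [_]; map)
open import Data.List.Properties using (++-assoc; ++-identityʳ; map-++)
open import Data.Product using (Σ; _×_; _,_)

record Category (o ℓ e : Level) : Set (lsuc (o ⊔ ℓ ⊔ e)) where
  infix  4 _≈_
  infixl 9 _⨾_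
  field
    Obj : Set o
    _⇒_ : Obj → Obj → Set ℓ
    _≈_ : ∀ {A B} → Rel (A ⇒ B) e
    id  : ∀ {A} → A ⇒ A
    -- diagrammatic composition  f ⨾ g  =  "f then g"
    _⨾_ : ∀ {A B C} → A ⇒ B → B ⇒ C → A ⇒ C
    ≈-equiv   : ∀ {A B} → IsEquivalence (_≈_ {A} {B})
    ⨾-resp-≈  : ∀ {A B C} {f f' : A ⇒ B} {g g' : B ⇒ C} →
                f ≈ f' → g ≈ g' → f ⨾ g ≈ f' ⨾ g'
    identityˡ : ∀ {A B} {f : A ⇒ B} → id ⨾ f ≈ f
    identityʳ : ∀ {A B} {f : A ⇒ B} → f ⨾ id ≈ f
    assoc     : ∀ {A B C D} {f : A ⇒ B} {g : B ⇒ C} {h : C ⇒ D} →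
                (f ⨾ g) ⨾ h ≈ f ⨾ (g ⨾ h)

  ≡⇒ : ∀ {A B} → A ≡ B → A ⇒ B
  ≡⇒ {A} p = subst (A ⇒_) p id

record Functor {o ℓ e o' ℓ' e'} (C : Category o ℓ e) (D : Category o' ℓ' e')
       : Set (o ⊔ ℓ ⊔ e ⊔ o' ⊔ ℓ' ⊔ e') where
  private
    module C = Category C
    module D = Category D
  field
    F₀ : C.Obj → D.Obj
    F₁ : ∀ {A B} → A C.⇒ B → F₀ A D.⇒ F₀ B
    F-resp-≈   : ∀ {A B} {f g : A C.⇒ B} → f C.≈ g → F₁ f D.≈ F₁ g
    F-identity : ∀ {A} → F₁ (C.id {A}) D.≈ D.id
    F-homo     : ∀ {A B C} {f : A C.⇒ B} {g : B C.⇒ C} →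
                 F₁ (f C.⨾ g) D.≈ F₁ f D.⨾ F₁ g

_⨾F_ : ∀ {o ℓ e o' ℓ' e' o'' ℓ'' e''}
         {C : Category o ℓ e} {D : Category o' ℓ' e'} {E : Category o'' ℓ'' e''} →
       Functor C D → Functor D E → Functor C E
_⨾F_ {C = C} {D} {E} F G = record
  { F₀ = λ X → G.F₀ (F.F₀ X)
  ; F₁ = λ f → G.F₁ (F.F₁ f)
  ; F-resp-≈ = λ p → G.F-resp-≈ (F.F-resp-≈ p)
  ; F-identity = E-trans (G.F-resp-≈ F.F-identity) G.F-identity
  ; F-homo = E-trans (G.F-resp-≈ F.F-homo) G.F-homo
  }
  where
    module F = Functor F
    module G = Functor G
    E-trans = λ {A B} {x y z} → IsEquivalence.trans (Category.≈-equiv E {A} {B}) {x} {y} {z}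

_≡F_ : ∀ {o ℓ e o' ℓ' e'} {C : Category o ℓ e} {D : Category o' ℓ' e'} →
       Functor C D → Functor C D → Set (o ⊔ ℓ ⊔ o' ⊔ e')
_≡F_ {C = C} {D} F G =
  Σ (∀ X → Functor.F₀ F X ≡ Functor.F₀ G X) λ eq →
    ∀ {A B} (f : Category._⇒_ C A B) →
      Category._≈_ D (subst₂ (Category._⇒_ D) (eq A) (eq B) (Functor.F₁ F f))
                     (Functor.F₁ G f)

record FBStructure {o ℓ e} (C : Category o ℓ e) : Set (o ⊔ ℓ ⊔ e) where
  open Category C
  infixr 10 _⊕₀_ _⊕₁_
  field
    _⊕₀_ : Obj → Obj → Obj
    𝟘    : Obj
    _⊕₁_ : ∀ {A B A' B'} → A ⇒ B → A' ⇒ B' → (A ⊕₀ A') ⇒ (B ⊕₀ B')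
    ⊕-resp-≈      : ∀ {A B A' B'} {f f' : A ⇒ B} {g g' : A' ⇒ B'} →
                    f ≈ f' → g ≈ g' → f ⊕₁ g ≈ f' ⊕₁ g'
    ⊕-identity    : ∀ {A B} → id {A} ⊕₁ id {B} ≈ id
    ⊕-interchange : ∀ {A B C A' B' C'} {f : A ⇒ B} {g : B ⇒ C}
                      {h : A' ⇒ B'} {k : B' ⇒ C'} →
                    (f ⨾ g) ⊕₁ (h ⨾ k) ≈ (f ⊕₁ h) ⨾ (g ⊕₁ k)
    ⊕-assoc₀ : ∀ A B C → (A ⊕₀ B) ⊕₀ C ≡ A ⊕₀ (B ⊕₀ C)
    ⊕-unitˡ₀ : ∀ A → 𝟘 ⊕₀ A ≡ A
    ⊕-unitʳ₀ : ∀ A → A ⊕₀ 𝟘 ≡ A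
    ⊕-assoc₁ : ∀ {A B C A' B' C'} (f : A ⇒ A') (g : B ⇒ B') (h : C ⇒ C') →
               ((f ⊕₁ g) ⊕₁ h) ⨾ ≡⇒ (⊕-assoc₀ A' B' C')
                 ≈ ≡⇒ (⊕-assoc₀ A B C) ⨾ (f ⊕₁ (g ⊕₁ h))
    ⊕-unitˡ₁ : ∀ {A B} (f : A ⇒ B) →
               (id {𝟘} ⊕₁ f) ⨾ ≡⇒ (⊕-unitˡ₀ B) ≈ ≡⇒ (⊕-unitˡ₀ A) ⨾ f
    ⊕-unitʳ₁ : ∀ {A B} (f : A ⇒ B) →
               (f ⊕₁ id {𝟘}) ⨾ ≡⇒ (⊕-unitʳ₀ B) ≈ ≡⇒ (⊕-unitʳ₀ A) ⨾ f
    σ : ∀ A B → (A ⊕₀ B) ⇒ (B ⊕₀ A)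
    σ-natural    : ∀ {A B A' B'} (f : A ⇒ A') (g : B ⇒ B') →
                   (f ⊕₁ g) ⨾ σ A' B' ≈ σ A B ⨾ (g ⊕₁ f)
    σ-involutive : ∀ A B → σ A B ⨾ σ B A ≈ id
    σ-hexagon    : ∀ A B C →
                   σ A (B ⊕₀ C) ≈ ≡⇒ (sym (⊕-assoc₀ A B C)) ⨾ (σ A B ⊕₁ id)
                                   ⨾ ≡⇒ (⊕-assoc₀ B A C) ⨾ (id ⊕₁ σ A C)
                                   ⨾ ≡⇒ (sym (⊕-assoc₀ B C A))

  mid4 : ∀ X Y → ((X ⊕₀ Y) ⊕₀ (X ⊕₀ Y)) ⇒ ((X ⊕₀ X) ⊕₀ (Y ⊕₀ Y))
  mid4 X Y = ≡⇒ (⊕-assoc₀ X Y (X ⊕₀ Y))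
             ⨾ (id {X} ⊕₁ (≡⇒ (sym (⊕-assoc₀ Y X Y)) ⨾ (σ Y X ⊕₁ id {Y})
                          ⨾ ≡⇒ (⊕-assoc₀ X Y Y)))
             ⨾ ≡⇒ (sym (⊕-assoc₀ X X (Y ⊕₀ Y)))
  mid4' : ∀ X Y → ((X ⊕₀ X) ⊕₀ (Y ⊕₀ Y)) ⇒ ((X ⊕₀ Y) ⊕₀ (X ⊕₀ Y))
  mid4' X Y = ≡⇒ (⊕-assoc₀ X X (Y ⊕₀ Y))
              ⨾ (id {X} ⊕₁ (≡⇒ (sym (⊕-assoc₀ X Y Y)) ⨾ (σ X Y ⊕₁ id {Y})
                           ⨾ ≡⇒ (⊕-assoc₀ Y X Y)))
              ⨾ ≡⇒ (sym (⊕-assoc₀ X Y (X ⊕₀ Y)))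

  field
    ∇ : ∀ X → (X ⊕₀ X) ⇒ X
    ι : ∀ X → 𝟘 ⇒ X
    Δ : ∀ X → X ⇒ (X ⊕₀ X)
    ! : ∀ X → X ⇒ 𝟘
    ∇-assoc  : ∀ X → (∇ X ⊕₁ id) ⨾ ∇ X ≈ ≡⇒ (⊕-assoc₀ X X X) ⨾ (id ⊕₁ ∇ X) ⨾ ∇ X
    ∇-unitˡ  : ∀ X → (ι X ⊕₁ id) ⨾ ∇ X ≈ ≡⇒ (⊕-unitˡ₀ X)
    ∇-unitʳ  : ∀ X → (id ⊕₁ ι X) ⨾ ∇ X ≈ ≡⇒ (⊕-unitʳ₀ X)
    ∇-comm   : ∀ X → σ X X ⨾ ∇ X ≈ ∇ X
    Δ-assoc  : ∀ X → Δ X ⨾ (Δ X ⊕₁ id) ⨾ ≡⇒ (⊕-assoc₀ X X X) ≈ Δ X ⨾ (id ⊕₁ Δ X)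
    Δ-unitˡ  : ∀ X → Δ X ⨾ (! X ⊕₁ id) ⨾ ≡⇒ (⊕-unitˡ₀ X) ≈ id
    Δ-unitʳ  : ∀ X → Δ X ⨾ (id ⊕₁ ! X) ⨾ ≡⇒ (⊕-unitʳ₀ X) ≈ id
    Δ-comm   : ∀ X → Δ X ⨾ σ X X ≈ Δ X
    ∇-⊕ : ∀ X Y → ∇ (X ⊕₀ Y) ≈ mid4 X Y ⨾ (∇ X ⊕₁ ∇ Y)
    ∇-𝟘 : ∇ 𝟘 ≈ ≡⇒ (⊕-unitˡ₀ 𝟘)
    ι-⊕ : ∀ X Y → ι (X ⊕₀ Y) ≈ ≡⇒ (sym (⊕-unitˡ₀ 𝟘)) ⨾ (ι X ⊕₁ ι Y)
    ι-𝟘 : ι 𝟘 ≈ id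
    Δ-⊕ : ∀ X Y → Δ (X ⊕₀ Y) ≈ (Δ X ⊕₁ Δ Y) ⨾ mid4' X Y
    Δ-𝟘 : Δ 𝟘 ≈ ≡⇒ (sym (⊕-unitˡ₀ 𝟘))
    !-⊕ : ∀ X Y → ! (X ⊕₀ Y) ≈ (! X ⊕₁ ! Y) ⨾ ≡⇒ (⊕-unitˡ₀ 𝟘)
    !-𝟘 : ! 𝟘 ≈ id
    ∇-natural : ∀ {X Y} (f : X ⇒ Y) → (f ⊕₁ f) ⨾ ∇ Y ≈ ∇ X ⨾ f
    ι-natural : ∀ {X Y} (f : X ⇒ Y) → ι X ⨾ f ≈ ι Y
    Δ-natural : ∀ {X Y} (f : X ⇒ Y) → f ⨾ Δ Y ≈ Δ X ⨾ (f ⊕₁ f)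
    !-natural : ∀ {X Y} (f : X ⇒ Y) → f ⨾ ! Y ≈ ! X

record FBCat (o ℓ e : Level) : Set (lsuc (o ⊔ ℓ ⊔ e)) where
  field
    cat : Category o ℓ e
    fb  : FBStructure cat
  open Category cat public
  open FBStructure fb public

U₂ : ∀ {o ℓ e} → FBCat o ℓ e → Category o ℓ e
U₂ = FBCat.cat

record IsFBFunctor {o ℓ e o' ℓ' e'} (D : FBCat o ℓ e) (D' : FBCat o' ℓ' e')
         (F₀ : FBCat.Obj D → FBCat.Obj D')
         (F₁ : ∀ {A B} → FBCat._⇒_ D A B → FBCat._⇒_ D' (F₀ A) (F₀ B))
       : Set (o ⊔ ℓ ⊔ e ⊔ o' ⊔ ℓ' ⊔ e') where
  private
    module D  = FBCat D
    module D' = FBCat D'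
  field
    F-resp-≈   : ∀ {A B} {f g : A D.⇒ B} → f D.≈ g → F₁ f D'.≈ F₁ g
    F-identity : ∀ {A} → F₁ (D.id {A}) D'.≈ D'.id
    F-homo     : ∀ {A B C} {f : A D.⇒ B} {g : B D.⇒ C} →
                 F₁ (f D.⨾ g) D'.≈ F₁ f D'.⨾ F₁ g
    ⊕₀-pres : ∀ A B → F₀ (A D.⊕₀ B) ≡ F₀ A D'.⊕₀ F₀ B
    𝟘-pres  : F₀ D.𝟘 ≡ D'.𝟘
    ⊕₁-pres : ∀ {A B A' B'} (f : A D.⇒ B) (g : A' D.⇒ B') →
              F₁ (f D.⊕₁ g) D'.⨾ D'.≡⇒ (⊕₀-pres B B')
                D'.≈ D'.≡⇒ (⊕₀-pres A A') D'.⨾ (F₁ f D'.⊕₁ F₁ g)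
    σ-pres  : ∀ A B → F₁ (D.σ A B) D'.⨾ D'.≡⇒ (⊕₀-pres B A)
                        D'.≈ D'.≡⇒ (⊕₀-pres A B) D'.⨾ D'.σ (F₀ A) (F₀ B)
    ∇-pres  : ∀ X → F₁ (D.∇ X) D'.≈ D'.≡⇒ (⊕₀-pres X X) D'.⨾ D'.∇ (F₀ X)
    ι-pres  : ∀ X → F₁ (D.ι X) D'.≈ D'.≡⇒ 𝟘-pres D'.⨾ D'.ι (F₀ X)
    Δ-pres  : ∀ X → F₁ (D.Δ X) D'.⨾ D'.≡⇒ (⊕₀-pres X X) D'.≈ D'.Δ (F₀ X)
    !-pres  : ∀ X → F₁ (D.! X) D'.⨾ D'.≡⇒ 𝟘-pres D'.≈ D'.! (F₀ X)

record FBFunctor {o ℓ e o' ℓ' e'} (D : FBCat o ℓ e) (D' : FBCat o' ℓ' e')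
       : Set (o ⊔ ℓ ⊔ e ⊔ o' ⊔ ℓ' ⊔ e') where
  field
    F₀ : FBCat.Obj D → FBCat.Obj D'
    F₁ : ∀ {A B} → FBCat._⇒_ D A B → FBCat._⇒_ D' (F₀ A) (F₀ B)
    isFBFunctor : IsFBFunctor D D' F₀ F₁
  open IsFBFunctor isFBFunctor public

U₂₁ : ∀ {o ℓ e o' ℓ' e'} {D : FBCat o ℓ e} {D' : FBCat o' ℓ' e'} →
      FBFunctor D D' → Functor (U₂ D) (U₂ D')
U₂₁ K = record
  { F₀ = FBFunctor.F₀ K
  ; F₁ = FBFunctor.F₁ K
  ; F-resp-≈ = FBFunctor.F-resp-≈ K
  ; F-identity = FBFunctor.F-identity K
  ; F-homo = FBFunctor.F-homo K
  }

module Free {o ℓ e} (C : Category o ℓ e) where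
  open Category C using (Obj; _⇒_; _≈_; id; _⨾_)

  infixl 9 _∙_
  infixr 10 _⊕ₜ_

  data Term : List Obj → List Obj → Set (o ⊔ ℓ) where
    idA  : ∀ A → Term [ A ] [ A ]
    id0  : Term [] []
    tape : ∀ {A B} → A ⇒ B → Term [ A ] [ B ]
    σA   : ∀ A B → Term (A ∷ B ∷ []) (B ∷ A ∷ [])
    !A   : ∀ A → Term [ A ] []
    ΔA   : ∀ A → Term [ A ] (A ∷ A ∷ [])
    ιA   : ∀ A → Term [] [ A ]
    ∇A   : ∀ A → Term (A ∷ A ∷ []) [ A ]
    _∙_  : ∀ {u v w} → Term u v → Term v w → Term u w
    _⊕ₜ_ : ∀ {u v u' v'} → Term u v → Term u' v' → Term (u ++ u') (v ++ v')

  idW : ∀ w → Term w w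
  idW []      = id0
  idW (A ∷ w) = idA A ⊕ₜ idW w

  castT : ∀ {u u' v v'} → u ≡ u' → v ≡ v' → Term u v → Term u' v'
  castT p q t = subst₂ Term p q t

  ≡⇒T : ∀ {u v} → u ≡ v → Term u v
  ≡⇒T {u} p = subst (Term u) p (idW u)

  σ1 : ∀ A v → Term (A ∷ v) (v ++ [ A ])
  σ1 A []      = idA A
  σ1 A (B ∷ v) = (σA A B ⊕ₜ idW v) ∙ (idA B ⊕ₜ σ1 A v)

  σW : ∀ u v → Term (u ++ v) (v ++ u)
  σW []      v = castT refl (sym (++-identityʳ v)) (idW v)
  σW (A ∷ u) v = (idA A ⊕ₜ σW u v)
                 ∙ castT refl (++-assoc v [ A ] u) (σ1 A v ⊕ₜ idW u)

  !W : ∀ w → Term w []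
  !W []      = id0
  !W (A ∷ w) = !A A ⊕ₜ !W w

  ιW : ∀ w → Term [] w
  ιW []      = id0
  ιW (A ∷ w) = ιA A ⊕ₜ ιW w

  ∇W : ∀ w → Term (w ++ w) w
  ∇W []      = id0
  ∇W (A ∷ w) = castT (cong (A ∷_) (++-assoc w [ A ] w)) refl
                 (idA A ⊕ₜ (σW w [ A ] ⊕ₜ idW w))
               ∙ (∇A A ⊕ₜ ∇W w)

  ΔW : ∀ w → Term w (w ++ w)
  ΔW []      = id0
  ΔW (A ∷ w) = (ΔA A ⊕ₜ ΔW w)
               ∙ castT refl (cong (A ∷_) (++-assoc w [ A ] w))
                   (idA A ⊕ₜ (σW [ A ] w ⊕ₜ idW w))

  mid4T : ∀ X Y → Term ((X ++ Y) ++ (X ++ Y)) ((X ++ X) ++ (Y ++ Y))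
  mid4T X Y = ≡⇒T (++-assoc X Y (X ++ Y))
              ∙ (idW X ⊕ₜ (≡⇒T (sym (++-assoc Y X Y)) ∙ (σW Y X ⊕ₜ idW Y)
                          ∙ ≡⇒T (++-assoc X Y Y)))
              ∙ ≡⇒T (sym (++-assoc X X (Y ++ Y)))

  mid4T' : ∀ X Y → Term ((X ++ X) ++ (Y ++ Y)) ((X ++ Y) ++ (X ++ Y))
  mid4T' X Y = ≡⇒T (++-assoc X X (Y ++ Y))
               ∙ (idW X ⊕ₜ (≡⇒T (sym (++-assoc X Y Y)) ∙ (σW X Y ⊕ₜ idW Y)
                           ∙ ≡⇒T (++-assoc Y X Y)))
               ∙ ≡⇒T (sym (++-assoc X Y (X ++ Y)))

  infix 4 _∼_
  data _∼_ : ∀ {u v} → Term u v → Term u v → Set (o ⊔ ℓ ⊔ e) where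
    ∼-refl  : ∀ {u v} {f : Term u v} → f ∼ f
    ∼-sym   : ∀ {u v} {f g : Term u v} → f ∼ g → g ∼ f
    ∼-trans : ∀ {u v} {f g h : Term u v} → f ∼ g → g ∼ h → f ∼ h
    ∙-cong  : ∀ {u v w} {f f' : Term u v} {g g' : Term v w} →
              f ∼ f' → g ∼ g' → f ∙ g ∼ f' ∙ g'
    ⊕-cong  : ∀ {u v u' v'} {f f' : Term u v} {g g' : Term u' v'} →
              f ∼ f' → g ∼ g' → f ⊕ₜ g ∼ f' ⊕ₜ g'
    tape-cong : ∀ {A B} {c d : A ⇒ B} → c ≈ d → tape c ∼ tape d
    tape-id   : ∀ {A} → tape (id {A}) ∼ idA A
    tape-⨾    : ∀ {A B C} {c : A ⇒ B} {d : B ⇒ C} → tape (c ⨾ d) ∼ tape c ∙ tape d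
    identityˡ : ∀ {u v} {f : Term u v} → idW u ∙ f ∼ f
    identityʳ : ∀ {u v} {f : Term u v} → f ∙ idW v ∼ f
    assoc     : ∀ {u v w x} {f : Term u v} {g : Term v w} {h : Term w x} →
                (f ∙ g) ∙ h ∼ f ∙ (g ∙ h)
    ⊕-identity    : ∀ {u v} → idW u ⊕ₜ idW v ∼ idW (u ++ v)
    ⊕-interchange : ∀ {u v w u' v' w'} {f : Term u v} {g : Term v w}
                      {h : Term u' v'} {k : Term v' w'} →
                    (f ∙ g) ⊕ₜ (h ∙ k) ∼ (f ⊕ₜ h) ∙ (g ⊕ₜ k)
    ⊕-assoc₁ : ∀ {A B C A' B' C'} (f : Term A A') (g : Term B B') (h : Term C C') →
               ((f ⊕ₜ g) ⊕ₜ h) ∙ ≡⇒T (++-assoc A' B' C')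
                 ∼ ≡⇒T (++-assoc A B C) ∙ (f ⊕ₜ (g ⊕ₜ h))
    ⊕-unitˡ₁ : ∀ {A B} (f : Term A B) →
               (idW [] ⊕ₜ f) ∙ ≡⇒T {B} refl ∼ ≡⇒T {A} refl ∙ f
    ⊕-unitʳ₁ : ∀ {A B} (f : Term A B) →
               (f ⊕ₜ idW []) ∙ ≡⇒T (++-identityʳ B) ∼ ≡⇒T (++-identityʳ A) ∙ f
    σ-natural    : ∀ {A B A' B'} (f : Term A A') (g : Term B B') →
                   (f ⊕ₜ g) ∙ σW A' B' ∼ σW A B ∙ (g ⊕ₜ f)
    σ-involutive : ∀ A B → σW A B ∙ σW B A ∼ idW (A ++ B)
    σ-hexagon    : ∀ A B C →
                   σW A (B ++ C) ∼ ≡⇒T (sym (++-assoc A B C)) ∙ (σW A B ⊕ₜ idW C)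
                                   ∙ ≡⇒T (++-assoc B A C) ∙ (idW B ⊕ₜ σW A C)
                                   ∙ ≡⇒T (sym (++-assoc B C A))
    ∇-assoc  : ∀ X → (∇W X ⊕ₜ idW X) ∙ ∇W X
                       ∼ ≡⇒T (++-assoc X X X) ∙ (idW X ⊕ₜ ∇W X) ∙ ∇W X
    ∇-unitˡ  : ∀ X → (ιW X ⊕ₜ idW X) ∙ ∇W X ∼ ≡⇒T {X} refl
    ∇-unitʳ  : ∀ X → (idW X ⊕ₜ ιW X) ∙ ∇W X ∼ ≡⇒T (++-identityʳ X)
    ∇-comm   : ∀ X → σW X X ∙ ∇W X ∼ ∇W X
    Δ-assoc  : ∀ X → ΔW X ∙ (ΔW X ⊕ₜ idW X) ∙ ≡⇒T (++-assoc X X X)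
                       ∼ ΔW X ∙ (idW X ⊕ₜ ΔW X)
    Δ-unitˡ  : ∀ X → ΔW X ∙ (!W X ⊕ₜ idW X) ∙ ≡⇒T {X} refl ∼ idW X
    Δ-unitʳ  : ∀ X → ΔW X ∙ (idW X ⊕ₜ !W X) ∙ ≡⇒T (++-identityʳ X) ∼ idW X
    Δ-comm   : ∀ X → ΔW X ∙ σW X X ∼ ΔW X
    ∇-⊕ : ∀ X Y → ∇W (X ++ Y) ∼ mid4T X Y ∙ (∇W X ⊕ₜ ∇W Y)
    ∇-𝟘 : ∇W [] ∼ ≡⇒T {[]} refl
    ι-⊕ : ∀ X Y → ιW (X ++ Y) ∼ ≡⇒T {[]} (sym refl) ∙ (ιW X ⊕ₜ ιW Y)
    ι-𝟘 : ιW [] ∼ idW []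
    Δ-⊕ : ∀ X Y → ΔW (X ++ Y) ∼ (ΔW X ⊕ₜ ΔW Y) ∙ mid4T' X Y
    Δ-𝟘 : ΔW [] ∼ ≡⇒T {[]} (sym refl)
    !-⊕ : ∀ X Y → !W (X ++ Y) ∼ (!W X ⊕ₜ !W Y) ∙ ≡⇒T {[]} refl
    !-𝟘 : !W [] ∼ idW []
    ∇-natural : ∀ {X Y} (f : Term X Y) → (f ⊕ₜ f) ∙ ∇W Y ∼ ∇W X ∙ f
    ι-natural : ∀ {X Y} (f : Term X Y) → ιW X ∙ f ∼ ιW Y
    Δ-natural : ∀ {X Y} (f : Term X Y) → f ∙ ΔW Y ∼ ΔW X ∙ (f ⊕ₜ f)
    !-natural : ∀ {X Y} (f : Term X Y) → f ∙ !W Y ∼ !W X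

  F₂-cat : Category o (o ⊔ ℓ) (o ⊔ ℓ ⊔ e)
  F₂-cat = record
    { Obj = List Obj
    ; _⇒_ = Term
    ; _≈_ = _∼_
    ; id = λ {A} → idW A
    ; _⨾_ = _∙_
    ; ≈-equiv = record { refl = ∼-refl ; sym = ∼-sym ; trans = ∼-trans }
    ; ⨾-resp-≈ = ∙-cong
    ; identityˡ = identityˡ
    ; identityʳ = identityʳ
    ; assoc = assoc
    }

  F₂-fb : FBStructure F₂-cat
  F₂-fb = record
    { _⊕₀_ = _++_
    ; 𝟘 = []
    ; _⊕₁_ = _⊕ₜ_
    ; ⊕-resp-≈ = ⊕-cong
    ; ⊕-identity = ⊕-identity
    ; ⊕-interchange = ⊕-interchange
    ; ⊕-assoc₀ = ++-assoc
    ; ⊕-unitˡ₀ = λ _ → refl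
    ; ⊕-unitʳ₀ = ++-identityʳ
    ; ⊕-assoc₁ = ⊕-assoc₁
    ; ⊕-unitˡ₁ = ⊕-unitˡ₁
    ; ⊕-unitʳ₁ = ⊕-unitʳ₁
    ; σ = σW
    ; σ-natural = σ-natural
    ; σ-involutive = σ-involutive
    ; σ-hexagon = σ-hexagon
    ; ∇ = ∇W ; ι = ιW ; Δ = ΔW ; ! = !W
    ; ∇-assoc = ∇-assoc ; ∇-unitˡ = ∇-unitˡ ; ∇-unitʳ = ∇-unitʳ ; ∇-comm = ∇-comm
    ; Δ-assoc = Δ-assoc ; Δ-unitˡ = Δ-unitˡ ; Δ-unitʳ = Δ-unitʳ ; Δ-comm = Δ-comm
    ; ∇-⊕ = ∇-⊕ ; ∇-𝟘 = ∇-𝟘 ; ι-⊕ = ι-⊕ ; ι-𝟘 = ι-𝟘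
    ; Δ-⊕ = Δ-⊕ ; Δ-𝟘 = Δ-𝟘 ; !-⊕ = !-⊕ ; !-𝟘 = !-𝟘
    ; ∇-natural = ∇-natural ; ι-natural = ι-natural
    ; Δ-natural = Δ-natural ; !-natural = !-natural
    }

F₂ : ∀ {ℓ} → Category ℓ ℓ ℓ → FBCat ℓ ℓ ℓ
F₂ C = record { cat = Free.F₂-cat C ; fb = Free.F₂-fb C }

F₂₁ : ∀ {o ℓ e o' ℓ' e'} {C : Category o ℓ e} {C' : Category o' ℓ' e'}
      (H : Functor C C') {u v : List (Category.Obj C)} →
      Free.Term C u v →
      Free.Term C' (map (Functor.F₀ H) u) (map (Functor.F₀ H) v)
F₂₁ {C = C} {C'} H = go
  where
    open Free C
    module T' = Free C'
    open Functor H
    go : ∀ {u v} → Term u v → T'.Term (map F₀ u) (map F₀ v)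
    go (idA A)  = T'.idA (F₀ A)
    go id0      = T'.id0
    go (tape c) = T'.tape (F₁ c)
    go (σA A B) = T'.σA (F₀ A) (F₀ B)
    go (!A A)   = T'.!A (F₀ A)
    go (ΔA A)   = T'.ΔA (F₀ A)
    go (ιA A)   = T'.ιA (F₀ A)
    go (∇A A)   = T'.∇A (F₀ A)
    go (f ∙ g)  = go f T'.∙ go g
    go (_⊕ₜ_ {u} {v} {u'} {v'} f g) =
      T'.castT (sym (map-++ F₀ u u')) (sym (map-++ F₀ v v')) (go f T'.⊕ₜ go g)

taping : ∀ {ℓ} (C : Category ℓ ℓ ℓ) → Functor C (U₂ (F₂ C))
taping C = record
  { F₀ = λ A → [ A ]
  ; F₁ = tape
  ; F-resp-≈ = tape-cong
  ; F-identity = ∼-trans tape-id idA≈id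
  ; F-homo = tape-⨾
  }
  where
    open Free C
    idA≈id : ∀ {A} → idA A ∼ idW [ A ]
    idA≈id {A} =
      ∼-trans (∼-sym identityˡ)
      (∼-trans (∼-sym (⊕-unitʳ₁ (idA A))) identityʳ)

-- The free extension G♯ of G : C → U₂ D sends a word A₁ … Aₙ to
-- G A₁ ⊕ (… ⊕ (G Aₙ ⊕ 𝟘)) and a term, by structural recursion, to the matching
-- structure of D.  By induction on words, the word-level symmetry and (co)monoids
-- of F₂(C) are sent to those of D at the interpreted objects (using the
-- compatibility of the (co)monoids with ⊕ and a second hexagon derived from the
-- first), so every generating law of F₂(C) holds in D and G♯ is well defined.
-- A strict fb functor K extending G agrees with G♯ on the generators, which are
-- its values at one-letter words, hence everywhere.  Finally F₂(H) is the free
-- extension of H followed by taping, so it is a strict fb functor for the same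
-- reason.
module Submission where

open import Defs
open import Level using (Level; _⊔_)
open import Relation.Binary.PropositionalEquality using (_≡_; refl; sym; trans; cong; cong₂; subst₂)
open import Relation.Binary using (Setoid; IsEquivalence)
import Relation.Binary.Reasoning.Setoid as SetoidReasoning
open import Data.List using (List; []; _∷_; _++_; [_]; map)
open import Data.List.Properties using (++-assoc; ++-identityʳ; map-++)
open import Data.Product using (Σ; _×_; _,_; proj₂)

module HomEquality {o ℓ e} (C : Category o ℓ e) where
  open Category C

  ≈-refl : ∀ {A B} {f : A ⇒ B} → f ≈ f
  ≈-refl = IsEquivalence.refl ≈-equiv

  ≈-sym : ∀ {A B} {f g : A ⇒ B} → f ≈ g → g ≈ f
  ≈-sym = IsEquivalence.sym ≈-equiv

  ≈-trans : ∀ {A B} {f g h : A ⇒ B} → f ≈ g → g ≈ h → f ≈ h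
  ≈-trans = IsEquivalence.trans ≈-equiv

  hom-setoid : Obj → Obj → Setoid ℓ e
  hom-setoid A B = record { Carrier = A ⇒ B ; _≈_ = _≈_ ; isEquivalence = ≈-equiv }

  module ≈-Reasoning {A B : Obj} = SetoidReasoning (hom-setoid A B)

  -- Compares arrows whose endpoints are only propositionally equal: a proof of
  -- f ≋ g identifies the endpoints and then gives f ≈ g.
  infix 4 _≋_
  data _≋_ {A B} (f : A ⇒ B) : ∀ {A' B'} → A' ⇒ B' → Set (ℓ ⊔ e) where
    het : {g : A ⇒ B} → f ≈ g → f ≋ g

  ≋-refl : ∀ {A B} {f : A ⇒ B} → f ≋ f
  ≋-refl = het ≈-refl

  ≋-sym : ∀ {A B A' B'} {f : A ⇒ B} {g : A' ⇒ B'} → f ≋ g → g ≋ f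
  ≋-sym (het p) = het (≈-sym p)

  infixr 2 _⟩_
  _⟩_ : ∀ {A B A' B' A'' B''} {f : A ⇒ B} {g : A' ⇒ B'} {h : A'' ⇒ B''} →
        f ≋ g → g ≋ h → f ≋ h
  het p ⟩ het q = het (≈-trans p q)

  ≋⇒≈ : ∀ {A B} {f g : A ⇒ B} → f ≋ g → f ≈ g
  ≋⇒≈ (het p) = p

  ⨾-resp-≋ : ∀ {A B C A' B' C'} {f : A ⇒ B} {g : B ⇒ C} {f' : A' ⇒ B'} {g' : B' ⇒ C'} →
             f ≋ f' → g ≋ g' → f ⨾ g ≋ f' ⨾ g'
  ⨾-resp-≋ (het p) (het q) = het (⨾-resp-≈ p q)

  id-≋ : ∀ {A B} → A ≡ B → id {A} ≋ id {B}
  id-≋ refl = ≋-refl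

  ≡⇒-≋-id : ∀ {A B} (p : A ≡ B) → ≡⇒ p ≋ id {A}
  ≡⇒-≋-id refl = ≋-refl

  subst₂-≋ : ∀ {A B A' B'} (p : A ≡ A') (q : B ≡ B') (f : A ⇒ B) →
             subst₂ _⇒_ p q f ≋ f
  subst₂-≋ refl refl f = ≋-refl

  ≋⇒subst₂-≈ : ∀ {A B A' B'} {f : A ⇒ B} {g : A' ⇒ B'} → f ≋ g →
               (p : A ≡ A') (q : B ≡ B') → subst₂ _⇒_ p q f ≈ g
  ≋⇒subst₂-≈ (het f≈g) refl refl = f≈g

  ⨾-identityˡ-≋ : ∀ {A B C} {f : A ⇒ B} {g : B ⇒ C} → f ≋ id {A} → f ⨾ g ≋ g
  ⨾-identityˡ-≋ (het f≈id) = het (≈-trans (⨾-resp-≈ f≈id ≈-refl) identityˡ)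

  ⨾-identityʳ-≋ : ∀ {A B C} {f : A ⇒ B} {g : B ⇒ C} → g ≋ id {B} → f ⨾ g ≋ f
  ⨾-identityʳ-≋ (het g≈id) = het (≈-trans (⨾-resp-≈ ≈-refl g≈id) identityʳ)

  ≡⇒-identityˡ : ∀ {A B C} (p : A ≡ B) {f : B ⇒ C} → ≡⇒ p ⨾ f ≋ f
  ≡⇒-identityˡ p = ⨾-identityˡ-≋ (≡⇒-≋-id p)

  ≡⇒-identityʳ : ∀ {A B C} {f : A ⇒ B} (p : B ≡ C) → f ⨾ ≡⇒ p ≋ f
  ≡⇒-identityʳ p = ⨾-identityʳ-≋ (≡⇒-≋-id p)

  ≡⇒-inverse : ∀ {A B} (p : A ≡ B) (q : B ≡ A) → ≡⇒ p ⨾ ≡⇒ q ≈ id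
  ≡⇒-inverse refl refl = identityˡ

  ≋⇒≡⇒-square : ∀ {A B A' B'} {f : A ⇒ B} {g : A' ⇒ B'} → f ≋ g →
                (p : B ≡ B') (q : A ≡ A') → f ⨾ ≡⇒ p ≈ ≡⇒ q ⨾ g
  ≋⇒≡⇒-square (het f≈g) refl refl =
    ≈-trans identityʳ (≈-trans f≈g (≈-sym identityˡ))

  ≡⇒-square⇒≋ : ∀ {A B A' B'} {f : A ⇒ B} {g : A' ⇒ B'} (p : B ≡ B') (q : A ≡ A') →
                f ⨾ ≡⇒ p ≈ ≡⇒ q ⨾ g → f ≋ g
  ≡⇒-square⇒≋ p q sq = ≋-sym (≡⇒-identityʳ p) ⟩ het sq ⟩ ≡⇒-identityˡ q

  ≋⇒≈-≡⇒⨾ : ∀ {A B A'} {f : A ⇒ B} {g : A' ⇒ B} → f ≋ g →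
            (q : A ≡ A') → f ≈ ≡⇒ q ⨾ g
  ≋⇒≈-≡⇒⨾ (het f≈g) refl = ≈-trans f≈g (≈-sym identityˡ)

  ⨾-resp-≋-via : ∀ {A B C A' B' B'' C'} {f : A ⇒ B} {g : B ⇒ C}
                   {f' : A' ⇒ B'} {g' : B'' ⇒ C'} (q : B' ≡ B'') →
                 f ≋ f' → g ≋ g' → f ⨾ g ≋ (f' ⨾ ≡⇒ q) ⨾ g'
  ⨾-resp-≋-via refl (het f≈f') (het g≈g') =
    het (⨾-resp-≈ (≈-trans f≈f' (≈-sym identityʳ)) g≈g')

  cancel-inner : ∀ {A B C E} {f : A ⇒ B} {g : B ⇒ C} {h : C ⇒ B} {k : B ⇒ E} →
                 g ⨾ h ≈ id → (f ⨾ g) ⨾ (h ⨾ k) ≈ f ⨾ k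
  cancel-inner {f = f} {g} {h} {k} gh≈id = begin
    (f ⨾ g) ⨾ (h ⨾ k)  ≈⟨ assoc ⟩
    f ⨾ (g ⨾ (h ⨾ k))  ≈⟨ ⨾-resp-≈ ≈-refl (≈-sym assoc) ⟩
    f ⨾ ((g ⨾ h) ⨾ k)  ≈⟨ ⨾-resp-≈ ≈-refl (⨾-resp-≈ gh≈id ≈-refl) ⟩
    f ⨾ (id ⨾ k)       ≈⟨ ⨾-resp-≈ ≈-refl identityˡ ⟩
    f ⨾ k              ∎
    where open ≈-Reasoning

  inverse-unique : ∀ {A B} {f h : A ⇒ B} {g : B ⇒ A} → f ⨾ g ≈ id → g ⨾ h ≈ id → f ≈ h
  inverse-unique {f = f} {h} {g} fg≈id gh≈id = begin
    f            ≈⟨ identityʳ ⟨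
    f ⨾ id       ≈⟨ ⨾-resp-≈ ≈-refl gh≈id ⟨
    f ⨾ (g ⨾ h)  ≈⟨ assoc ⟨
    (f ⨾ g) ⨾ h  ≈⟨ ⨾-resp-≈ fg≈id ≈-refl ⟩
    id ⨾ h       ≈⟨ identityˡ ⟩
    h            ∎
    where open ≈-Reasoning

  right-inverse-of-id : ∀ {X Y} {f : X ⇒ Y} {g : Y ⇒ X} → f ≋ id {X} → f ⨾ g ≈ id → g ≋ id {Y}
  right-inverse-of-id (het f≈id) fg≈id =
    het (≈-trans (≈-sym identityˡ) (≈-trans (⨾-resp-≈ (≈-sym f≈id) ≈-refl) fg≈id))

module FBProperties {o ℓ e} (D : FBCat o ℓ e) where
  open FBCat D
  open HomEquality cat

  ⊕-resp-≋ : ∀ {A B C D A' B' C' D'} {f : A ⇒ B} {g : C ⇒ D} {f' : A' ⇒ B'} {g' : C' ⇒ D'} →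
             f ≋ f' → g ≋ g' → f ⊕₁ g ≋ f' ⊕₁ g'
  ⊕-resp-≋ (het p) (het q) = het (⊕-resp-≈ p q)

  ⊕-id-≋ : ∀ {A B C D} {f : A ⇒ B} {g : C ⇒ D} → f ≋ id {A} → g ≋ id {C} → f ⊕₁ g ≋ id {A ⊕₀ C}
  ⊕-id-≋ f≋id g≋id = ⊕-resp-≋ f≋id g≋id ⟩ het ⊕-identity

  σ-≋ : ∀ {A B A' B'} → A ≡ A' → B ≡ B' → σ A B ≋ σ A' B'
  σ-≋ refl refl = ≋-refl

  ∇-≋ : ∀ {A A'} → A ≡ A' → ∇ A ≋ ∇ A'
  ∇-≋ refl = ≋-refl

  Δ-≋ : ∀ {A A'} → A ≡ A' → Δ A ≋ Δ A'
  Δ-≋ refl = ≋-refl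

  ι-≋ : ∀ {A A'} → A ≡ A' → ι A ≋ ι A'
  ι-≋ refl = ≋-refl

  !-≋ : ∀ {A A'} → A ≡ A' → ! A ≋ ! A'
  !-≋ refl = ≋-refl

  ⊕-unitˡ-≋ : ∀ {A B} (f : A ⇒ B) → id {𝟘} ⊕₁ f ≋ f
  ⊕-unitˡ-≋ f = ≡⇒-square⇒≋ (⊕-unitˡ₀ _) (⊕-unitˡ₀ _) (⊕-unitˡ₁ f)

  ⊕-unitʳ-≋ : ∀ {A B} (f : A ⇒ B) → f ⊕₁ id {𝟘} ≋ f
  ⊕-unitʳ-≋ f = ≡⇒-square⇒≋ (⊕-unitʳ₀ _) (⊕-unitʳ₀ _) (⊕-unitʳ₁ f)

  ⊕-assoc-≋ : ∀ {A B C A' B' C'} (f : A ⇒ A') (g : B ⇒ B') (h : C ⇒ C') →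
              (f ⊕₁ g) ⊕₁ h ≋ f ⊕₁ (g ⊕₁ h)
  ⊕-assoc-≋ f g h = ≡⇒-square⇒≋ (⊕-assoc₀ _ _ _) (⊕-assoc₀ _ _ _) (⊕-assoc₁ f g h)

  σ-hexagon-≋ : ∀ A B C →
                σ A (B ⊕₀ C) ≋ ((σ A B ⊕₁ id {C}) ⨾ ≡⇒ (⊕-assoc₀ B A C)) ⨾ (id {B} ⊕₁ σ A C)
  σ-hexagon-≋ A B C =
    het (σ-hexagon A B C) ⟩ ≡⇒-identityʳ _ ⟩ ⨾-resp-≋ (⨾-resp-≋ (≡⇒-identityˡ _) ≋-refl) ≋-refl

  -- The hexagon at (A, 𝟘, 𝟘) gives s ≋ (s ⨾ ≡⇒ p) ⨾ s; cancelling the invertible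
  -- s = σ A 𝟘 on the right leaves s ⨾ ≡⇒ p ≈ id.
  σ-unitʳ : ∀ A → σ A 𝟘 ≋ id {A ⊕₀ 𝟘}
  σ-unitʳ A = ≋-sym (≡⇒-identityʳ p) ⟩ het s⨾p≈id
    where
      s = σ A 𝟘
      p : 𝟘 ⊕₀ A ≡ A ⊕₀ 𝟘
      p = trans (⊕-unitˡ₀ A) (sym (⊕-unitʳ₀ A))

      s≋s⨾p⨾s : s ≋ (s ⨾ ≡⇒ p) ⨾ s
      s≋s⨾p⨾s = σ-≋ refl (sym (⊕-unitˡ₀ 𝟘)) ⟩ σ-hexagon-≋ A 𝟘 𝟘
              ⟩ ⨾-resp-≋-via p (⨾-identityʳ-≋ (≡⇒-≋-id _) ⟩ ⊕-unitʳ-≋ s) (⊕-unitˡ-≋ s)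

      s⨾p≈id : s ⨾ ≡⇒ p ≈ id
      s⨾p≈id = begin
        s ⨾ ≡⇒ p                     ≈⟨ identityʳ ⟨
        (s ⨾ ≡⇒ p) ⨾ id              ≈⟨ ⨾-resp-≈ ≈-refl (σ-involutive A 𝟘) ⟨
        (s ⨾ ≡⇒ p) ⨾ (s ⨾ σ 𝟘 A)     ≈⟨ assoc ⟨
        ((s ⨾ ≡⇒ p) ⨾ s) ⨾ σ 𝟘 A     ≈⟨ ⨾-resp-≈ (≋⇒≈ s≋s⨾p⨾s) ≈-refl ⟨
        s ⨾ σ 𝟘 A                    ≈⟨ σ-involutive A 𝟘 ⟩
        id                           ∎
        where open ≈-Reasoning

  σ-unitˡ : ∀ A → σ 𝟘 A ≋ id {𝟘 ⊕₀ A}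
  σ-unitˡ A = right-inverse-of-id (σ-unitʳ A) (σ-involutive A 𝟘)

  -- The second hexagon: the inverse of σ V (A ⊕₀ U), expanded by the first hexagon.
  σ-hexagon₂-≋ : ∀ A U V →
                 σ (A ⊕₀ U) V ≋ ((id {A} ⊕₁ σ U V) ⨾ ≡⇒ (sym (⊕-assoc₀ A V U))) ⨾ (σ A V ⊕₁ id {U})
  σ-hexagon₂-≋ A U V = het σ≈R' ⟩ ⨾-resp-≋ (≡⇒-identityˡ a₀) ≋-refl ⟩ ≡⇒-identityʳ a₂
    where
      a₀ = ⊕-assoc₀ A U V
      a₁ = ⊕-assoc₀ A V U
      a₂ = ⊕-assoc₀ V A U
      R = ((id {A} ⊕₁ σ U V) ⨾ ≡⇒ (sym a₁)) ⨾ (σ A V ⊕₁ id {U})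
      R' = (≡⇒ a₀ ⨾ R) ⨾ ≡⇒ a₂
      S = ((σ V A ⊕₁ id {U}) ⨾ ≡⇒ a₁) ⨾ (id {A} ⊕₁ σ V U)

      inner : (id {A} ⊕₁ σ V U) ⨾ (id {A} ⊕₁ σ U V) ≈ id
      inner = ≈-trans (≈-sym ⊕-interchange)
                (≈-trans (⊕-resp-≈ identityˡ (σ-involutive V U)) ⊕-identity)

      outer : (σ V A ⊕₁ id {U}) ⨾ (σ A V ⊕₁ id {U}) ≈ id
      outer = ≈-trans (≈-sym ⊕-interchange)
                (≈-trans (⊕-resp-≈ (σ-involutive V A) identityˡ) ⊕-identity)

      S⨾R≈id : S ⨾ R ≈ id
      S⨾R≈id = ≈-trans (⨾-resp-≈ ≈-refl assoc)
                 (≈-trans (cancel-inner inner)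
                   (≈-trans (cancel-inner (≡⇒-inverse a₁ (sym a₁))) outer))

      σ⨾R'≈id : σ V (A ⊕₀ U) ⨾ R' ≈ id
      σ⨾R'≈id = ≋⇒≈ (⨾-resp-≋ (σ-hexagon-≋ V A U) (≡⇒-identityʳ a₂ ⟩ ≡⇒-identityˡ a₀)
                     ⟩ het S⨾R≈id ⟩ id-≋ a₂)

      σ≈R' : σ (A ⊕₀ U) V ≈ R'
      σ≈R' = inverse-unique (σ-involutive (A ⊕₀ U) V) σ⨾R'≈id

  mid4-≋ : ∀ X Y → mid4 X Y ≋ id {X} ⊕₁ (σ Y X ⊕₁ id {Y})
  mid4-≋ X Y = ≡⇒-identityʳ _ ⟩ ≡⇒-identityˡ _
             ⟩ ⊕-resp-≋ ≋-refl (≡⇒-identityʳ _ ⟩ ≡⇒-identityˡ _)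

  mid4'-≋ : ∀ X Y → mid4' X Y ≋ id {X} ⊕₁ (σ X Y ⊕₁ id {Y})
  mid4'-≋ X Y = ≡⇒-identityʳ _ ⟩ ≡⇒-identityˡ _
              ⟩ ⊕-resp-≋ ≋-refl (≡⇒-identityʳ _ ⟩ ≡⇒-identityˡ _)

module Interpretation {o ℓ e o' ℓ' e'} (C : Category o ℓ e) (D : FBCat o' ℓ' e')
                      (G : Functor C (U₂ D)) where
  open FBCat D
  open HomEquality cat
  open FBProperties D
  open Free C using (Term; idA; id0; tape; σA; !A; ΔA; ιA; ∇A; _∙_; _⊕ₜ_;
                     idW; castT; ≡⇒T; σ1; σW; !W; ιW; ∇W; ΔW; mid4T; mid4T'; _∼_)
  module C = Category C
  module G = Functor G

  ⟦_⟧₀ : List C.Obj → Obj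
  ⟦ [] ⟧₀    = 𝟘
  ⟦ A ∷ w ⟧₀ = G.F₀ A ⊕₀ ⟦ w ⟧₀

  ⟦++⟧ : ∀ u v → ⟦ u ++ v ⟧₀ ≡ ⟦ u ⟧₀ ⊕₀ ⟦ v ⟧₀
  ⟦++⟧ []      v = sym (⊕-unitˡ₀ ⟦ v ⟧₀)
  ⟦++⟧ (A ∷ u) v = trans (cong (G.F₀ A ⊕₀_) (⟦++⟧ u v)) (sym (⊕-assoc₀ (G.F₀ A) ⟦ u ⟧₀ ⟦ v ⟧₀))

  ⟦[_]⟧ : ∀ A → ⟦ [ A ] ⟧₀ ≡ G.F₀ A
  ⟦[ A ]⟧ = ⊕-unitʳ₀ (G.F₀ A)

  ⟦_⟧₁ : ∀ {u v} → Term u v → ⟦ u ⟧₀ ⇒ ⟦ v ⟧₀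
  ⟦ idA A ⟧₁   = id
  ⟦ id0 ⟧₁     = id
  ⟦ tape c ⟧₁  = G.F₁ c ⊕₁ id {𝟘}
  ⟦ σA A B ⟧₁  = ≡⇒ (cong (G.F₀ A ⊕₀_) ⟦[ B ]⟧) ⨾ σ (G.F₀ A) (G.F₀ B)
                 ⨾ ≡⇒ (cong (G.F₀ B ⊕₀_) (sym ⟦[ A ]⟧))
  ⟦ !A A ⟧₁    = ≡⇒ ⟦[ A ]⟧ ⨾ ! (G.F₀ A)
  ⟦ ΔA A ⟧₁    = ≡⇒ ⟦[ A ]⟧ ⨾ Δ (G.F₀ A) ⨾ ≡⇒ (cong (G.F₀ A ⊕₀_) (sym ⟦[ A ]⟧))
  ⟦ ιA A ⟧₁    = ι (G.F₀ A) ⨾ ≡⇒ (sym ⟦[ A ]⟧)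
  ⟦ ∇A A ⟧₁    = ≡⇒ (cong (G.F₀ A ⊕₀_) ⟦[ A ]⟧) ⨾ ∇ (G.F₀ A) ⨾ ≡⇒ (sym ⟦[ A ]⟧)
  ⟦ f ∙ g ⟧₁   = ⟦ f ⟧₁ ⨾ ⟦ g ⟧₁
  ⟦ _⊕ₜ_ {u} {v} {u'} {v'} f g ⟧₁ = ≡⇒ (⟦++⟧ u u') ⨾ (⟦ f ⟧₁ ⊕₁ ⟦ g ⟧₁) ⨾ ≡⇒ (sym (⟦++⟧ v v'))

  ⟦⊕ₜ⟧ : ∀ {u v u' v'} (f : Term u v) (g : Term u' v') → ⟦ f ⊕ₜ g ⟧₁ ≋ ⟦ f ⟧₁ ⊕₁ ⟦ g ⟧₁
  ⟦⊕ₜ⟧ f g = ≡⇒-identityʳ _ ⟩ ≡⇒-identityˡ _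

  ⟦castT⟧ : ∀ {u u' v v'} (p : u ≡ u') (q : v ≡ v') (t : Term u v) → ⟦ castT p q t ⟧₁ ≋ ⟦ t ⟧₁
  ⟦castT⟧ refl refl t = ≋-refl

  ⟦idA⟧ : ∀ A → ⟦ idA A ⟧₁ ≋ id {G.F₀ A}
  ⟦idA⟧ A = id-≋ ⟦[ A ]⟧

  ⟦tape⟧ : ∀ {A B} (c : A C.⇒ B) → ⟦ tape c ⟧₁ ≋ G.F₁ c
  ⟦tape⟧ c = ⊕-unitʳ-≋ _

  ⟦σA⟧ : ∀ A B → ⟦ σA A B ⟧₁ ≋ σ (G.F₀ A) (G.F₀ B)
  ⟦σA⟧ A B = ≡⇒-identityʳ _ ⟩ ≡⇒-identityˡ _

  ⟦∇A⟧ : ∀ A → ⟦ ∇A A ⟧₁ ≋ ∇ (G.F₀ A)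
  ⟦∇A⟧ A = ≡⇒-identityʳ _ ⟩ ≡⇒-identityˡ _

  ⟦ΔA⟧ : ∀ A → ⟦ ΔA A ⟧₁ ≋ Δ (G.F₀ A)
  ⟦ΔA⟧ A = ≡⇒-identityʳ _ ⟩ ≡⇒-identityˡ _

  ⟦ιA⟧ : ∀ A → ⟦ ιA A ⟧₁ ≋ ι (G.F₀ A)
  ⟦ιA⟧ A = ≡⇒-identityʳ _

  ⟦!A⟧ : ∀ A → ⟦ !A A ⟧₁ ≋ ! (G.F₀ A)
  ⟦!A⟧ A = ≡⇒-identityˡ _

  ⟦idW⟧ : ∀ w → ⟦ idW w ⟧₁ ≋ id {⟦ w ⟧₀}
  ⟦idW⟧ []      = ≋-refl
  ⟦idW⟧ (A ∷ w) = ⟦⊕ₜ⟧ (idA A) (idW w) ⟩ ⊕-id-≋ ≋-refl (⟦idW⟧ w)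
                ⟩ id-≋ (cong (_⊕₀ ⟦ w ⟧₀) ⟦[ A ]⟧)

  ⟦≡⇒T⟧ : ∀ {u v} (p : u ≡ v) → ⟦ ≡⇒T p ⟧₁ ≋ id {⟦ u ⟧₀}
  ⟦≡⇒T⟧ {u} refl = ⟦idW⟧ u

  ⟦σ1⟧ : ∀ A v → ⟦ σ1 A v ⟧₁ ≋ σ (G.F₀ A) ⟦ v ⟧₀
  ⟦σ1⟧ A []      = ≋-sym (σ-unitʳ (G.F₀ A))
  ⟦σ1⟧ A (B ∷ v) =
    ⨾-resp-≋-via (⊕-assoc₀ (G.F₀ B) (G.F₀ A) ⟦ v ⟧₀)
      (⟦⊕ₜ⟧ (σA A B) (idW v) ⟩ ⊕-resp-≋ (⟦σA⟧ A B) (⟦idW⟧ v))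
      (⟦⊕ₜ⟧ (idA B) (σ1 A v) ⟩ ⊕-resp-≋ (⟦idA⟧ B) (⟦σ1⟧ A v))
    ⟩ ≋-sym (σ-hexagon-≋ (G.F₀ A) (G.F₀ B) ⟦ v ⟧₀)

  ⟦σW⟧ : ∀ u v → ⟦ σW u v ⟧₁ ≋ σ ⟦ u ⟧₀ ⟦ v ⟧₀
  ⟦σW⟧ [] v = ⟦castT⟧ refl (sym (++-identityʳ v)) (idW v) ⟩ ⟦idW⟧ v
            ⟩ id-≋ (sym (⊕-unitˡ₀ ⟦ v ⟧₀)) ⟩ ≋-sym (σ-unitˡ ⟦ v ⟧₀)
  ⟦σW⟧ (A ∷ u) v =
    ⨾-resp-≋-via (sym (⊕-assoc₀ (G.F₀ A) ⟦ v ⟧₀ ⟦ u ⟧₀))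
      (⟦⊕ₜ⟧ (idA A) (σW u v) ⟩ ⊕-resp-≋ (⟦idA⟧ A) (⟦σW⟧ u v))
      (⟦castT⟧ refl (++-assoc v [ A ] u) (σ1 A v ⊕ₜ idW u)
        ⟩ ⟦⊕ₜ⟧ (σ1 A v) (idW u) ⟩ ⊕-resp-≋ (⟦σ1⟧ A v) (⟦idW⟧ u))
    ⟩ ≋-sym (σ-hexagon₂-≋ (G.F₀ A) ⟦ u ⟧₀ ⟦ v ⟧₀)

  ⟦!W⟧ : ∀ w → ⟦ !W w ⟧₁ ≋ ! ⟦ w ⟧₀
  ⟦!W⟧ []      = ≋-sym (het !-𝟘)
  ⟦!W⟧ (A ∷ w) = ⟦⊕ₜ⟧ (!A A) (!W w) ⟩ ⊕-resp-≋ (⟦!A⟧ A) (⟦!W⟧ w)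
               ⟩ ≋-sym (≡⇒-identityʳ _) ⟩ ≋-sym (het (!-⊕ _ _))

  ⟦ιW⟧ : ∀ w → ⟦ ιW w ⟧₁ ≋ ι ⟦ w ⟧₀
  ⟦ιW⟧ []      = ≋-sym (het ι-𝟘)
  ⟦ιW⟧ (A ∷ w) = ⟦⊕ₜ⟧ (ιA A) (ιW w) ⟩ ⊕-resp-≋ (⟦ιA⟧ A) (⟦ιW⟧ w)
               ⟩ ≋-sym (≡⇒-identityˡ _) ⟩ ≋-sym (het (ι-⊕ _ _))

  ⟦∇W⟧ : ∀ w → ⟦ ∇W w ⟧₁ ≋ ∇ ⟦ w ⟧₀
  ⟦∇W⟧ []      = ≋-sym (het ∇-𝟘 ⟩ ≡⇒-≋-id _ ⟩ id-≋ (⊕-unitˡ₀ 𝟘))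
  ⟦∇W⟧ (A ∷ w) = ⨾-resp-≋ shuffle (⟦⊕ₜ⟧ (∇A A) (∇W w) ⟩ ⊕-resp-≋ (⟦∇A⟧ A) (⟦∇W⟧ w))
               ⟩ ≋-sym (het (∇-⊕ _ _))
    where
      shuffle = ⟦castT⟧ (cong (A ∷_) (++-assoc w [ A ] w)) refl (idA A ⊕ₜ (σW w [ A ] ⊕ₜ idW w))
              ⟩ ⟦⊕ₜ⟧ (idA A) (σW w [ A ] ⊕ₜ idW w)
              ⟩ ⊕-resp-≋ (⟦idA⟧ A) (⟦⊕ₜ⟧ (σW w [ A ]) (idW w)
                  ⟩ ⊕-resp-≋ (⟦σW⟧ w [ A ] ⟩ σ-≋ refl ⟦[ A ]⟧) (⟦idW⟧ w))
              ⟩ ≋-sym (mid4-≋ (G.F₀ A) ⟦ w ⟧₀)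

  ⟦ΔW⟧ : ∀ w → ⟦ ΔW w ⟧₁ ≋ Δ ⟦ w ⟧₀
  ⟦ΔW⟧ []      = ≋-sym (het Δ-𝟘 ⟩ ≡⇒-≋-id _)
  ⟦ΔW⟧ (A ∷ w) = ⨾-resp-≋ (⟦⊕ₜ⟧ (ΔA A) (ΔW w) ⟩ ⊕-resp-≋ (⟦ΔA⟧ A) (⟦ΔW⟧ w)) shuffle
               ⟩ ≋-sym (het (Δ-⊕ _ _))
    where
      shuffle = ⟦castT⟧ refl (cong (A ∷_) (++-assoc w [ A ] w)) (idA A ⊕ₜ (σW [ A ] w ⊕ₜ idW w))
              ⟩ ⟦⊕ₜ⟧ (idA A) (σW [ A ] w ⊕ₜ idW w)
              ⟩ ⊕-resp-≋ (⟦idA⟧ A) (⟦⊕ₜ⟧ (σW [ A ] w) (idW w)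
                  ⟩ ⊕-resp-≋ (⟦σW⟧ [ A ] w ⟩ σ-≋ ⟦[ A ]⟧ refl) (⟦idW⟧ w))
              ⟩ ≋-sym (mid4'-≋ (G.F₀ A) ⟦ w ⟧₀)

  ⟦mid4T⟧ : ∀ X Y → ⟦ mid4T X Y ⟧₁ ≋ mid4 ⟦ X ⟧₀ ⟦ Y ⟧₀
  ⟦mid4T⟧ X Y =
    ⨾-identityʳ-≋ (⟦≡⇒T⟧ (sym (++-assoc X X (Y ++ Y))))
    ⟩ ⨾-identityˡ-≋ (⟦≡⇒T⟧ (++-assoc X Y (X ++ Y)))
    ⟩ ⟦⊕ₜ⟧ (idW X) inner
    ⟩ ⊕-resp-≋ (⟦idW⟧ X)
        (⨾-identityʳ-≋ (⟦≡⇒T⟧ (++-assoc X Y Y)) ⟩ ⨾-identityˡ-≋ (⟦≡⇒T⟧ (sym (++-assoc Y X Y)))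
         ⟩ ⟦⊕ₜ⟧ (σW Y X) (idW Y) ⟩ ⊕-resp-≋ (⟦σW⟧ Y X) (⟦idW⟧ Y))
    ⟩ ≋-sym (mid4-≋ ⟦ X ⟧₀ ⟦ Y ⟧₀)
    where inner = ≡⇒T (sym (++-assoc Y X Y)) ∙ (σW Y X ⊕ₜ idW Y) ∙ ≡⇒T (++-assoc X Y Y)

  ⟦mid4T'⟧ : ∀ X Y → ⟦ mid4T' X Y ⟧₁ ≋ mid4' ⟦ X ⟧₀ ⟦ Y ⟧₀
  ⟦mid4T'⟧ X Y =
    ⨾-identityʳ-≋ (⟦≡⇒T⟧ (sym (++-assoc X Y (X ++ Y))))
    ⟩ ⨾-identityˡ-≋ (⟦≡⇒T⟧ (++-assoc X X (Y ++ Y)))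
    ⟩ ⟦⊕ₜ⟧ (idW X) inner
    ⟩ ⊕-resp-≋ (⟦idW⟧ X)
        (⨾-identityʳ-≋ (⟦≡⇒T⟧ (++-assoc Y X Y)) ⟩ ⨾-identityˡ-≋ (⟦≡⇒T⟧ (sym (++-assoc X Y Y)))
         ⟩ ⟦⊕ₜ⟧ (σW X Y) (idW Y) ⟩ ⊕-resp-≋ (⟦σW⟧ X Y) (⟦idW⟧ Y))
    ⟩ ≋-sym (mid4'-≋ ⟦ X ⟧₀ ⟦ Y ⟧₀)
    where inner = ≡⇒T (sym (++-assoc X Y Y)) ∙ (σW X Y ⊕ₜ idW Y) ∙ ≡⇒T (++-assoc Y X Y)

  ⟦⟧₁-resp-∼ : ∀ {u v} {f g : Term u v} → f ∼ g → ⟦ f ⟧₁ ≋ ⟦ g ⟧₁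
  ⟦⟧₁-resp-∼ Free.∼-refl = ≋-refl
  ⟦⟧₁-resp-∼ (Free.∼-sym p) = ≋-sym (⟦⟧₁-resp-∼ p)
  ⟦⟧₁-resp-∼ (Free.∼-trans p q) = ⟦⟧₁-resp-∼ p ⟩ ⟦⟧₁-resp-∼ q
  ⟦⟧₁-resp-∼ (Free.∙-cong p q) = ⨾-resp-≋ (⟦⟧₁-resp-∼ p) (⟦⟧₁-resp-∼ q)
  ⟦⟧₁-resp-∼ (Free.⊕-cong {f = f} {f'} {g} {g'} p q) =
    ⟦⊕ₜ⟧ f g ⟩ ⊕-resp-≋ (⟦⟧₁-resp-∼ p) (⟦⟧₁-resp-∼ q) ⟩ ≋-sym (⟦⊕ₜ⟧ f' g')
  ⟦⟧₁-resp-∼ (Free.tape-cong p) = ⊕-resp-≋ (het (G.F-resp-≈ p)) ≋-refl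
  ⟦⟧₁-resp-∼ Free.tape-id = ⊕-id-≋ (het G.F-identity) ≋-refl
  ⟦⟧₁-resp-∼ Free.tape-⨾ = het (≈-trans (⊕-resp-≈ G.F-homo (≈-sym identityˡ)) ⊕-interchange)
  ⟦⟧₁-resp-∼ (Free.identityˡ {u}) = ⨾-identityˡ-≋ (⟦idW⟧ u)
  ⟦⟧₁-resp-∼ (Free.identityʳ {v = v}) = ⨾-identityʳ-≋ (⟦idW⟧ v)
  ⟦⟧₁-resp-∼ Free.assoc = het assoc
  ⟦⟧₁-resp-∼ (Free.⊕-identity {u} {v}) =
    ⟦⊕ₜ⟧ (idW u) (idW v) ⟩ ⊕-id-≋ (⟦idW⟧ u) (⟦idW⟧ v)
    ⟩ id-≋ (sym (⟦++⟧ u v)) ⟩ ≋-sym (⟦idW⟧ (u ++ v))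
  ⟦⟧₁-resp-∼ (Free.⊕-interchange {f = f} {g} {h} {k}) =
    ⟦⊕ₜ⟧ (f ∙ g) (h ∙ k) ⟩ het ⊕-interchange ⟩ ⨾-resp-≋ (≋-sym (⟦⊕ₜ⟧ f h)) (≋-sym (⟦⊕ₜ⟧ g k))
  ⟦⟧₁-resp-∼ (Free.⊕-assoc₁ {A} {B} {C} {A'} {B'} {C'} f g h) =
    ⨾-identityʳ-≋ (⟦≡⇒T⟧ (++-assoc A' B' C'))
    ⟩ ⟦⊕ₜ⟧ (f ⊕ₜ g) h ⟩ ⊕-resp-≋ (⟦⊕ₜ⟧ f g) ≋-refl
    ⟩ ⊕-assoc-≋ ⟦ f ⟧₁ ⟦ g ⟧₁ ⟦ h ⟧₁
    ⟩ ⊕-resp-≋ ≋-refl (≋-sym (⟦⊕ₜ⟧ g h)) ⟩ ≋-sym (⟦⊕ₜ⟧ f (g ⊕ₜ h))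
    ⟩ ≋-sym (⨾-identityˡ-≋ (⟦≡⇒T⟧ (++-assoc A B C)))
  ⟦⟧₁-resp-∼ (Free.⊕-unitˡ₁ {A} {B} f) =
    ⨾-identityʳ-≋ (⟦idW⟧ B) ⟩ ⟦⊕ₜ⟧ id0 f ⟩ ⊕-unitˡ-≋ ⟦ f ⟧₁ ⟩ ≋-sym (⨾-identityˡ-≋ (⟦idW⟧ A))
  ⟦⟧₁-resp-∼ (Free.⊕-unitʳ₁ {A} {B} f) =
    ⨾-identityʳ-≋ (⟦≡⇒T⟧ (++-identityʳ B)) ⟩ ⟦⊕ₜ⟧ f id0 ⟩ ⊕-unitʳ-≋ ⟦ f ⟧₁
    ⟩ ≋-sym (⨾-identityˡ-≋ (⟦≡⇒T⟧ (++-identityʳ A)))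
  ⟦⟧₁-resp-∼ (Free.σ-natural {A} {B} {A'} {B'} f g) =
    ⨾-resp-≋ (⟦⊕ₜ⟧ f g) (⟦σW⟧ A' B') ⟩ het (σ-natural ⟦ f ⟧₁ ⟦ g ⟧₁)
    ⟩ ≋-sym (⨾-resp-≋ (⟦σW⟧ A B) (⟦⊕ₜ⟧ g f))
  ⟦⟧₁-resp-∼ (Free.σ-involutive A B) =
    ⨾-resp-≋ (⟦σW⟧ A B) (⟦σW⟧ B A) ⟩ het (σ-involutive _ _)
    ⟩ id-≋ (sym (⟦++⟧ A B)) ⟩ ≋-sym (⟦idW⟧ (A ++ B))
  ⟦⟧₁-resp-∼ (Free.σ-hexagon A B C) =
    ⟦σW⟧ A (B ++ C) ⟩ σ-≋ refl (⟦++⟧ B C) ⟩ σ-hexagon-≋ ⟦ A ⟧₀ ⟦ B ⟧₀ ⟦ C ⟧₀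
    ⟩ ≋-sym (⨾-identityʳ-≋ (⟦≡⇒T⟧ (sym (++-assoc B C A)))
             ⟩ ⨾-resp-≋-via (⊕-assoc₀ ⟦ B ⟧₀ ⟦ A ⟧₀ ⟦ C ⟧₀)
                 (⨾-identityʳ-≋ (⟦≡⇒T⟧ (++-assoc B A C))
                  ⟩ ⨾-identityˡ-≋ (⟦≡⇒T⟧ (sym (++-assoc A B C)))
                  ⟩ ⟦⊕ₜ⟧ (σW A B) (idW C) ⟩ ⊕-resp-≋ (⟦σW⟧ A B) (⟦idW⟧ C))
                 (⟦⊕ₜ⟧ (idW B) (σW A C) ⟩ ⊕-resp-≋ (⟦idW⟧ B) (⟦σW⟧ A C)))
  ⟦⟧₁-resp-∼ (Free.∇-assoc X) =
    ⨾-resp-≋ (⟦⊕ₜ⟧ (∇W X) (idW X) ⟩ ⊕-resp-≋ (⟦∇W⟧ X) (⟦idW⟧ X)) (⟦∇W⟧ X)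
    ⟩ het (∇-assoc _)
    ⟩ ≋-sym (⨾-resp-≋ (⨾-identityˡ-≋ (⟦≡⇒T⟧ (++-assoc X X X))
                        ⟩ ⟦⊕ₜ⟧ (idW X) (∇W X) ⟩ ⊕-resp-≋ (⟦idW⟧ X) (⟦∇W⟧ X)
                        ⟩ ≋-sym (≡⇒-identityˡ _))
                       (⟦∇W⟧ X))
  ⟦⟧₁-resp-∼ (Free.∇-unitˡ X) =
    ⨾-resp-≋ (⟦⊕ₜ⟧ (ιW X) (idW X) ⟩ ⊕-resp-≋ (⟦ιW⟧ X) (⟦idW⟧ X)) (⟦∇W⟧ X)
    ⟩ het (∇-unitˡ _) ⟩ ≡⇒-≋-id _ ⟩ id-≋ (⊕-unitˡ₀ _) ⟩ ≋-sym (⟦≡⇒T⟧ {X} refl)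
  ⟦⟧₁-resp-∼ (Free.∇-unitʳ X) =
    ⨾-resp-≋ (⟦⊕ₜ⟧ (idW X) (ιW X) ⟩ ⊕-resp-≋ (⟦idW⟧ X) (⟦ιW⟧ X)) (⟦∇W⟧ X)
    ⟩ het (∇-unitʳ _) ⟩ ≡⇒-≋-id _ ⟩ id-≋ (sym (⟦++⟧ X [])) ⟩ ≋-sym (⟦≡⇒T⟧ (++-identityʳ X))
  ⟦⟧₁-resp-∼ (Free.∇-comm X) =
    ⨾-resp-≋ (⟦σW⟧ X X) (⟦∇W⟧ X) ⟩ het (∇-comm _) ⟩ ≋-sym (⟦∇W⟧ X)
  ⟦⟧₁-resp-∼ (Free.Δ-assoc X) =
    ⨾-identityʳ-≋ (⟦≡⇒T⟧ (++-assoc X X X))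
    ⟩ ⨾-resp-≋ (⟦ΔW⟧ X) (⟦⊕ₜ⟧ (ΔW X) (idW X) ⟩ ⊕-resp-≋ (⟦ΔW⟧ X) (⟦idW⟧ X))
    ⟩ ≋-sym (≡⇒-identityʳ _) ⟩ het (Δ-assoc _)
    ⟩ ≋-sym (⨾-resp-≋ (⟦ΔW⟧ X) (⟦⊕ₜ⟧ (idW X) (ΔW X) ⟩ ⊕-resp-≋ (⟦idW⟧ X) (⟦ΔW⟧ X)))
  ⟦⟧₁-resp-∼ (Free.Δ-unitˡ X) =
    ⨾-identityʳ-≋ (⟦≡⇒T⟧ {X} refl)
    ⟩ ⨾-resp-≋ (⟦ΔW⟧ X) (⟦⊕ₜ⟧ (!W X) (idW X) ⟩ ⊕-resp-≋ (⟦!W⟧ X) (⟦idW⟧ X))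
    ⟩ ≋-sym (≡⇒-identityʳ _) ⟩ het (Δ-unitˡ _) ⟩ ≋-sym (⟦idW⟧ X)
  ⟦⟧₁-resp-∼ (Free.Δ-unitʳ X) =
    ⨾-identityʳ-≋ (⟦≡⇒T⟧ (++-identityʳ X))
    ⟩ ⨾-resp-≋ (⟦ΔW⟧ X) (⟦⊕ₜ⟧ (idW X) (!W X) ⟩ ⊕-resp-≋ (⟦idW⟧ X) (⟦!W⟧ X))
    ⟩ ≋-sym (≡⇒-identityʳ _) ⟩ het (Δ-unitʳ _) ⟩ ≋-sym (⟦idW⟧ X)
  ⟦⟧₁-resp-∼ (Free.Δ-comm X) =
    ⨾-resp-≋ (⟦ΔW⟧ X) (⟦σW⟧ X X) ⟩ het (Δ-comm _) ⟩ ≋-sym (⟦ΔW⟧ X)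
  ⟦⟧₁-resp-∼ (Free.∇-⊕ X Y) =
    ⟦∇W⟧ (X ++ Y) ⟩ ∇-≋ (⟦++⟧ X Y) ⟩ het (∇-⊕ _ _)
    ⟩ ≋-sym (⨾-resp-≋ (⟦mid4T⟧ X Y) (⟦⊕ₜ⟧ (∇W X) (∇W Y) ⟩ ⊕-resp-≋ (⟦∇W⟧ X) (⟦∇W⟧ Y)))
  ⟦⟧₁-resp-∼ Free.∇-𝟘 = ≋-refl
  ⟦⟧₁-resp-∼ (Free.ι-⊕ X Y) =
    ⟦ιW⟧ (X ++ Y) ⟩ ι-≋ (⟦++⟧ X Y) ⟩ het (ι-⊕ _ _) ⟩ ≡⇒-identityˡ _
    ⟩ ≋-sym (⨾-identityˡ-≋ (⟦≡⇒T⟧ {[]} refl)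
             ⟩ ⟦⊕ₜ⟧ (ιW X) (ιW Y) ⟩ ⊕-resp-≋ (⟦ιW⟧ X) (⟦ιW⟧ Y))
  ⟦⟧₁-resp-∼ Free.ι-𝟘 = ≋-refl
  ⟦⟧₁-resp-∼ (Free.Δ-⊕ X Y) =
    ⟦ΔW⟧ (X ++ Y) ⟩ Δ-≋ (⟦++⟧ X Y) ⟩ het (Δ-⊕ _ _)
    ⟩ ≋-sym (⨾-resp-≋ (⟦⊕ₜ⟧ (ΔW X) (ΔW Y) ⟩ ⊕-resp-≋ (⟦ΔW⟧ X) (⟦ΔW⟧ Y)) (⟦mid4T'⟧ X Y))
  ⟦⟧₁-resp-∼ Free.Δ-𝟘 = ≋-refl
  ⟦⟧₁-resp-∼ (Free.!-⊕ X Y) =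
    ⟦!W⟧ (X ++ Y) ⟩ !-≋ (⟦++⟧ X Y) ⟩ het (!-⊕ _ _) ⟩ ≡⇒-identityʳ _
    ⟩ ≋-sym (⨾-identityʳ-≋ (⟦≡⇒T⟧ {[]} refl)
             ⟩ ⟦⊕ₜ⟧ (!W X) (!W Y) ⟩ ⊕-resp-≋ (⟦!W⟧ X) (⟦!W⟧ Y))
  ⟦⟧₁-resp-∼ Free.!-𝟘 = ≋-refl
  ⟦⟧₁-resp-∼ (Free.∇-natural {X} {Y} f) =
    ⨾-resp-≋ (⟦⊕ₜ⟧ f f) (⟦∇W⟧ Y) ⟩ het (∇-natural ⟦ f ⟧₁) ⟩ ≋-sym (⨾-resp-≋ (⟦∇W⟧ X) ≋-refl)
  ⟦⟧₁-resp-∼ (Free.ι-natural {X} {Y} f) =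
    ⨾-resp-≋ (⟦ιW⟧ X) ≋-refl ⟩ het (ι-natural ⟦ f ⟧₁) ⟩ ≋-sym (⟦ιW⟧ Y)
  ⟦⟧₁-resp-∼ (Free.Δ-natural {X} {Y} f) =
    ⨾-resp-≋ ≋-refl (⟦ΔW⟧ Y) ⟩ het (Δ-natural ⟦ f ⟧₁) ⟩ ≋-sym (⨾-resp-≋ (⟦ΔW⟧ X) (⟦⊕ₜ⟧ f f))
  ⟦⟧₁-resp-∼ (Free.!-natural {X} {Y} f) =
    ⨾-resp-≋ ≋-refl (⟦!W⟧ Y) ⟩ het (!-natural ⟦ f ⟧₁) ⟩ ≋-sym (⟦!W⟧ X)

module Letters {ℓ} (C : Category ℓ ℓ ℓ) where
  open HomEquality (U₂ (F₂ C))
  open FBProperties (F₂ C)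
  open Free C using (idA; tape; σA; !A; ΔA; ιA; ∇A; idW; σW; !W; ιW; ∇W; ΔW)

  idA-≋-idW : ∀ A → idA A ≋ idW [ A ]
  idA-≋-idW A = ≋-sym (⊕-unitʳ-≋ (idA A))

  !W-≋-!A : ∀ A → !W [ A ] ≋ !A A
  !W-≋-!A A = ⊕-unitʳ-≋ (!A A)

  ιW-≋-ιA : ∀ A → ιW [ A ] ≋ ιA A
  ιW-≋-ιA A = ⊕-unitʳ-≋ (ιA A)

  σW-≋-σA : ∀ A B → σW [ A ] [ B ] ≋ σA A B
  σW-≋-σA A B = ⨾-identityˡ-≋ (⊕-id-≋ (idA-≋-idW A) (subst₂-≋ _ _ _))
              ⟩ subst₂-≋ _ _ _ ⟩ ⊕-unitʳ-≋ _
              ⟩ ⨾-identityʳ-≋ (⊕-id-≋ (idA-≋-idW B) (idA-≋-idW A)) ⟩ ⊕-unitʳ-≋ _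

  ∇W-≋-∇A : ∀ A → ∇W [ A ] ≋ ∇A A
  ∇W-≋-∇A A = ⨾-identityˡ-≋ (subst₂-≋ _ _ _ ⟩ ⊕-id-≋ (idA-≋-idW A) (⊕-id-≋ (σ-unitˡ [ A ]) ≋-refl))
            ⟩ ⊕-unitʳ-≋ (∇A A)

  ΔW-≋-ΔA : ∀ A → ΔW [ A ] ≋ ΔA A
  ΔW-≋-ΔA A = ⨾-identityʳ-≋ (subst₂-≋ _ _ _ ⟩ ⊕-id-≋ (idA-≋-idW A) (⊕-id-≋ (σ-unitʳ [ A ]) ≋-refl))
            ⟩ ⊕-unitʳ-≋ (ΔA A)

module Universal {ℓ} (C : Category ℓ ℓ ℓ) (D : FBCat ℓ ℓ ℓ) (G : Functor C (U₂ D)) where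
  open FBCat D
  open HomEquality cat
  open FBProperties D
  open Interpretation C D G
  module F₂C = HomEquality (U₂ (F₂ C))
  module T = Free C
  open Letters C

  G♯ : FBFunctor (F₂ C) D
  G♯ = record
    { F₀ = ⟦_⟧₀
    ; F₁ = ⟦_⟧₁
    ; isFBFunctor = record
      { F-resp-≈   = λ p → ≋⇒≈ (⟦⟧₁-resp-∼ p)
      ; F-identity = λ {A} → ≋⇒≈ (⟦idW⟧ A)
      ; F-homo     = ≈-refl
      ; ⊕₀-pres    = ⟦++⟧
      ; 𝟘-pres     = refl
      ; ⊕₁-pres    = λ {A} {B} {A'} {B'} f g → ≋⇒≡⇒-square (⟦⊕ₜ⟧ f g) (⟦++⟧ B B') (⟦++⟧ A A')
      ; σ-pres     = λ A B → ≋⇒≡⇒-square (⟦σW⟧ A B) (⟦++⟧ B A) (⟦++⟧ A B)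
      ; ∇-pres     = λ X → ≋⇒≈-≡⇒⨾ (⟦∇W⟧ X) (⟦++⟧ X X)
      ; ι-pres     = λ X → ≋⇒≈-≡⇒⨾ (⟦ιW⟧ X) refl
      ; Δ-pres     = λ X → ≋⇒≈ (≡⇒-identityʳ _ ⟩ ⟦ΔW⟧ X)
      ; !-pres     = λ X → ≋⇒≈ (≡⇒-identityʳ _ ⟩ ⟦!W⟧ X)
      }
    }

  G♯-extends : (taping C ⨾F U₂₁ G♯) ≡F G
  G♯-extends = ⟦[_]⟧ , λ c → ≋⇒subst₂-≈ (⟦tape⟧ c) _ _

  module _ (K : FBFunctor (F₂ C) D) (K-extends : (taping C ⨾F U₂₁ K) ≡F G) where
    module K = FBFunctor K
    open Σ K-extends renaming (proj₁ to K₀-ext; proj₂ to K₁-ext)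

    K-resp-≋ : ∀ {u v u' v'} {f : T.Term u v} {g : T.Term u' v'} → f F₂C.≋ g → K.F₁ f ≋ K.F₁ g
    K-resp-≋ (F₂C.het f∼g) = het (K.F-resp-≈ f∼g)

    K₀≡⟦⟧₀ : ∀ w → K.F₀ w ≡ ⟦ w ⟧₀
    K₀≡⟦⟧₀ []      = K.𝟘-pres
    K₀≡⟦⟧₀ (A ∷ w) = trans (K.⊕₀-pres [ A ] w) (cong₂ _⊕₀_ (K₀-ext A) (K₀≡⟦⟧₀ w))

    K₁≋⟦⟧₁ : ∀ {u v} (f : T.Term u v) → K.F₁ f ≋ ⟦ f ⟧₁
    K₁≋⟦⟧₁ (T.idA A) = K-resp-≋ (idA-≋-idW A) ⟩ het K.F-identity ⟩ id-≋ (K₀≡⟦⟧₀ [ A ])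
    K₁≋⟦⟧₁ T.id0     = het K.F-identity ⟩ id-≋ K.𝟘-pres
    K₁≋⟦⟧₁ (T.tape c) = ≋-sym (subst₂-≋ _ _ _) ⟩ het (K₁-ext c) ⟩ ≋-sym (⟦tape⟧ c)
    K₁≋⟦⟧₁ (T.σA A B) =
      K-resp-≋ (F₂C.≋-sym (σW-≋-σA A B))
      ⟩ ≡⇒-square⇒≋ (K.⊕₀-pres [ B ] [ A ]) (K.⊕₀-pres [ A ] [ B ]) (K.σ-pres [ A ] [ B ])
      ⟩ σ-≋ (K₀-ext A) (K₀-ext B) ⟩ ≋-sym (⟦σA⟧ A B)
    K₁≋⟦⟧₁ (T.∇A A) =
      K-resp-≋ (F₂C.≋-sym (∇W-≋-∇A A)) ⟩ het (K.∇-pres [ A ]) ⟩ ≡⇒-identityˡ _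
      ⟩ ∇-≋ (K₀-ext A) ⟩ ≋-sym (⟦∇A⟧ A)
    K₁≋⟦⟧₁ (T.ΔA A) =
      K-resp-≋ (F₂C.≋-sym (ΔW-≋-ΔA A)) ⟩ ≋-sym (≡⇒-identityʳ _) ⟩ het (K.Δ-pres [ A ])
      ⟩ Δ-≋ (K₀-ext A) ⟩ ≋-sym (⟦ΔA⟧ A)
    K₁≋⟦⟧₁ (T.ιA A) =
      K-resp-≋ (F₂C.≋-sym (ιW-≋-ιA A)) ⟩ het (K.ι-pres [ A ]) ⟩ ≡⇒-identityˡ _
      ⟩ ι-≋ (K₀-ext A) ⟩ ≋-sym (⟦ιA⟧ A)
    K₁≋⟦⟧₁ (T.!A A) =
      K-resp-≋ (F₂C.≋-sym (!W-≋-!A A)) ⟩ ≋-sym (≡⇒-identityʳ _) ⟩ het (K.!-pres [ A ])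
      ⟩ !-≋ (K₀-ext A) ⟩ ≋-sym (⟦!A⟧ A)
    K₁≋⟦⟧₁ (f T.∙ g) = het K.F-homo ⟩ ⨾-resp-≋ (K₁≋⟦⟧₁ f) (K₁≋⟦⟧₁ g)
    K₁≋⟦⟧₁ (T._⊕ₜ_ {u} {v} {u'} {v'} f g) =
      ≡⇒-square⇒≋ (K.⊕₀-pres v v') (K.⊕₀-pres u u') (K.⊕₁-pres f g)
      ⟩ ⊕-resp-≋ (K₁≋⟦⟧₁ f) (K₁≋⟦⟧₁ g) ⟩ ≋-sym (⟦⊕ₜ⟧ f g)

    G♯-unique : U₂₁ K ≡F U₂₁ G♯
    G♯-unique = K₀≡⟦⟧₀ , λ f → ≋⇒subst₂-≈ (K₁≋⟦⟧₁ f) (K₀≡⟦⟧₀ _) (K₀≡⟦⟧₀ _)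

module Functoriality {ℓ} {C C' : Category ℓ ℓ ℓ} (H : Functor C C') where
  open HomEquality (U₂ (F₂ C'))
  open FBProperties (F₂ C')
  open Interpretation C (F₂ C') (H ⨾F taping C')
  open Letters C'
  module H = Functor H
  module T = Free C
  module T' = Free C'

  ⟦⟧₀≡map : ∀ w → ⟦ w ⟧₀ ≡ map H.F₀ w
  ⟦⟧₀≡map []      = refl
  ⟦⟧₀≡map (A ∷ w) = cong (H.F₀ A ∷_) (⟦⟧₀≡map w)

  -- F₂₁ H {a} {b} recurses through a local function that keeps the outer indices
  -- a, b fixed, so on a subterm it is not F₂₁ H at the subterm's own indices.
  -- F₂₁-at a b f exposes that local function at a, b on any term f, as the middle
  -- factor of the image of a composite  a → u —f→ v → b.
  middle : ∀ {x y} → T'.Term x y → Σ (List (Category.Obj C') × List (Category.Obj C'))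
                                      (λ (u , v) → T'.Term u v)
  middle ((_ T'.∙ f) T'.∙ _) = (_ , _) , f
  middle _                   = ([] , []) , T'.id0

  F₂₁-at : ∀ a b {u v} (f : T.Term u v) → T'.Term (map H.F₀ u) (map H.F₀ v)
  F₂₁-at a b {u} {v} f =
    proj₂ (middle (F₂₁ H {a} {b} ((T.!W a T.∙ T.ιW u) T.∙ f T.∙ (T.!W v T.∙ T.ιW b))))

  F₂₁-at-≋-⟦⟧₁ : ∀ a b {u v} (f : T.Term u v) → F₂₁-at a b f ≋ ⟦ f ⟧₁
  F₂₁-at-≋-⟦⟧₁ a b (T.idA A)  = idA-≋-idW (H.F₀ A)
  F₂₁-at-≋-⟦⟧₁ a b T.id0      = ≋-refl
  F₂₁-at-≋-⟦⟧₁ a b (T.tape c) = ≋-sym (⟦tape⟧ c)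
  F₂₁-at-≋-⟦⟧₁ a b (T.σA A B) = ≋-sym (σW-≋-σA _ _) ⟩ ≋-sym (⟦σA⟧ A B)
  F₂₁-at-≋-⟦⟧₁ a b (T.∇A A)   = ≋-sym (∇W-≋-∇A _) ⟩ ≋-sym (⟦∇A⟧ A)
  F₂₁-at-≋-⟦⟧₁ a b (T.ΔA A)   = ≋-sym (ΔW-≋-ΔA _) ⟩ ≋-sym (⟦ΔA⟧ A)
  F₂₁-at-≋-⟦⟧₁ a b (T.ιA A)   = ≋-sym (ιW-≋-ιA _) ⟩ ≋-sym (⟦ιA⟧ A)
  F₂₁-at-≋-⟦⟧₁ a b (T.!A A)   = ≋-sym (!W-≋-!A _) ⟩ ≋-sym (⟦!A⟧ A)
  F₂₁-at-≋-⟦⟧₁ a b (f T.∙ g)  =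
    ⨾-resp-≋ {f = F₂₁-at a b f} {g = F₂₁-at a b g} (F₂₁-at-≋-⟦⟧₁ a b f) (F₂₁-at-≋-⟦⟧₁ a b g)
  F₂₁-at-≋-⟦⟧₁ a b (f T.⊕ₜ g) =
    subst₂-≋ _ _ _ ⟩ ⊕-resp-≋ (F₂₁-at-≋-⟦⟧₁ a b f) (F₂₁-at-≋-⟦⟧₁ a b g) ⟩ ≋-sym (⟦⊕ₜ⟧ f g)

  F₂₁-≋-⟦⟧₁ : ∀ {u v} (f : T.Term u v) → F₂₁ H f ≋ ⟦ f ⟧₁
  F₂₁-≋-⟦⟧₁ {u} {v} = F₂₁-at-≋-⟦⟧₁ u v

  F₂₁-isFBFunctor : IsFBFunctor (F₂ C) (F₂ C') (map H.F₀) (F₂₁ H)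
  F₂₁-isFBFunctor = record
    { F-resp-≈   = λ {_} {_} {f} {g} f∼g →
                     ≋⇒≈ (F₂₁-≋-⟦⟧₁ f ⟩ ⟦⟧₁-resp-∼ f∼g ⟩ ≋-sym (F₂₁-≋-⟦⟧₁ g))
    ; F-identity = λ {w} → ≋⇒≈ (F₂₁-≋-⟦⟧₁ (T.idW w) ⟩ ⟦idW⟧ w ⟩ id-≋ (⟦⟧₀≡map w))
    ; F-homo     = λ {_} {_} {_} {f} {g} →
                     ≋⇒≈ (F₂₁-≋-⟦⟧₁ (f T.∙ g)
                          ⟩ ≋-sym (⨾-resp-≋ {f = F₂₁ H f} {g = F₂₁ H g}
                                     (F₂₁-≋-⟦⟧₁ f) (F₂₁-≋-⟦⟧₁ g)))
    ; ⊕₀-pres    = map-++ H.F₀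
    ; 𝟘-pres     = refl
    ; ⊕₁-pres    = λ f g → ≋⇒≡⇒-square
                     (F₂₁-≋-⟦⟧₁ (f T.⊕ₜ g) ⟩ ⟦⊕ₜ⟧ f g
                      ⟩ ≋-sym (⊕-resp-≋ (F₂₁-≋-⟦⟧₁ f) (F₂₁-≋-⟦⟧₁ g))) _ _
    ; σ-pres     = λ u v → ≋⇒≡⇒-square
                     (F₂₁-≋-⟦⟧₁ (T.σW u v) ⟩ ⟦σW⟧ u v ⟩ σ-≋ (⟦⟧₀≡map u) (⟦⟧₀≡map v)) _ _
    ; ∇-pres     = λ w → ≋⇒≈-≡⇒⨾ (F₂₁-≋-⟦⟧₁ (T.∇W w) ⟩ ⟦∇W⟧ w ⟩ ∇-≋ (⟦⟧₀≡map w)) _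
    ; ι-pres     = λ w → ≋⇒≈-≡⇒⨾ (F₂₁-≋-⟦⟧₁ (T.ιW w) ⟩ ⟦ιW⟧ w ⟩ ι-≋ (⟦⟧₀≡map w)) refl
    ; Δ-pres     = λ w → ≋⇒≈ (≡⇒-identityʳ _ ⟩ F₂₁-≋-⟦⟧₁ (T.ΔW w) ⟩ ⟦ΔW⟧ w ⟩ Δ-≋ (⟦⟧₀≡map w))
    ; !-pres     = λ w → ≋⇒≈ (≡⇒-identityʳ _ ⟩ F₂₁-≋-⟦⟧₁ (T.!W w) ⟩ ⟦!W⟧ w ⟩ !-≋ (⟦⟧₀≡map w))
    }

lemma5p2 : ∀ {ℓ : Level} →
    -- F₂ is a functor Cat → FBC: for each functor H, the termwise action F₂₁ H
    -- (together with map H₀ on words) is a well-defined strict fb functor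
    (∀ {C C' : Category ℓ ℓ ℓ} (H : Functor C C') →
       IsFBFunctor (F₂ C) (F₂ C') (map (Functor.F₀ H)) (F₂₁ H))
    -- taping is natural:  F₂(H) ⌈c⌉ = ⌈H c⌉
    × (∀ {C C' : Category ℓ ℓ ℓ} (H : Functor C C') {A B : Category.Obj C}
         (c : Category._⇒_ C A B) →
         F₂₁ H (Free.tape c) ≡ Free.tape (Functor.F₁ H c))
    -- universality of the unit ⌈·⌉ : C → U₂ F₂(C)
    × (∀ (C : Category ℓ ℓ ℓ) (D : FBCat ℓ ℓ ℓ) (G : Functor C (U₂ D)) →
         Σ (FBFunctor (F₂ C) D) λ G♯ →
           ((taping C ⨾F U₂₁ G♯) ≡F G)
           × (∀ (K : FBFunctor (F₂ C) D) → (taping C ⨾F U₂₁ K) ≡F G →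
                U₂₁ K ≡F U₂₁ G♯))
lemma5p2 = (λ H → Functoriality.F₂₁-isFBFunctor H)
         , (λ H c → refl)
         , (λ C D G → let open Universal C D G in
                      G♯ , G♯-extends , G♯-unique)
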